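{- For $n,k\ge0$ let $r_{n,k}$ be the number of run-sorted permutations of $[n]$ having exactly $k$ runs (with $r_{0,0}=1$, $r_{1,0}=0$, $r_{1,1}=1$). Then for all $n\ge2$ and $k\ge1$, $$r_{n,k}=k\,r_{n-1,k}+(n-2)\,r_{n-2,k-1}.$$
   Context: A run of a permutation $\pi=\pi_1\cdots\pi_n$ (one-line notation) is a maximal increasing factor of consecutive letters. A permutation of $[n]$ is run-sorted if it is obtained by concatenating the blocks of a set partition $B_1/\cdots/B_k$ of $[n]$ written in block representation (elements of each block in increasing order, blocks ordered so that $\min B_1<\cdots<\min B_k$); equivalently, the minima of its successive runs are increasing. The empty permutation has $0$ runs. -}

module Defs where

open import Data.Nat using (ℕ; zero; suc; _<ᵇ_; _≡ᵇ_)
open import Data.Bool using (Bool; true; false; _∧_; not; if_then_else_)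
open import Data.List using (List; []; _∷_; map; length; upTo; filterᵇ; concatMap)

words : ℕ → List ℕ → List (List ℕ)
words zero    as = [] ∷ []
words (suc m) as = concatMap (λ a → map (a ∷_) (words m as)) as

notIn : ℕ → List ℕ → Bool
notIn a []       = true
notIn a (x ∷ xs) = not (a ≡ᵇ x) ∧ notIn a xs

distinct : List ℕ → Bool
distinct []       = true
distinct (x ∷ xs) = notIn x xs ∧ distinct xs

[_] : ℕ → List ℕ
[ n ] = map suc (upTo n)

perms : ℕ → List (List ℕ)
perms n = filterᵇ distinct (words n [ n ])

runs : List ℕ → List (List ℕ)
runs [] = []
runs (x ∷ xs) with runs xs
... | [] = (x ∷ []) ∷ []
... | [] ∷ rs = (x ∷ []) ∷ [] ∷ rs
... | (y ∷ r) ∷ rs = if x <ᵇ y then (x ∷ y ∷ r) ∷ rs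
                                else (x ∷ []) ∷ (y ∷ r) ∷ rs

-- minimum of a (nonempty) list; 0 for the empty list (never used on runs)
minL : List ℕ → ℕ
minL [] = 0
minL (x ∷ []) = x
minL (x ∷ y ∷ ys) = let m = minL (y ∷ ys) in if x <ᵇ m then x else m

increasing : List ℕ → Bool
increasing [] = true
increasing (x ∷ []) = true
increasing (x ∷ y ∷ ys) = (x <ᵇ y) ∧ increasing (y ∷ ys)

runSorted : List ℕ → Bool
runSorted w = increasing (map minL (runs w))

r : ℕ → ℕ → ℕ
r n k = length (filterᵇ (λ w → runSorted w ∧ (length (runs w) ≡ᵇ k)) (perms n))

module Submission where

-- Reading off the run minima shows that a word is run-sorted with k runs iff the
-- list of letters that start a run (the first letter, and every letter not larger than its
-- predecessor) is increasing of length k. Every permutation of [n] arises exactly once by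
-- inserting n into a permutation ρ of [n-1]. If n goes at the end of a run of ρ, the run
-- starts do not change; these are k gaps (the very front is never allowed, since then n
-- would be the first run start). Otherwise n goes just before a letter y in the interior of
-- a run, and y becomes a new run start. Removing y and standardising the rest gives a
-- run-sorted permutation σ of [n-2] with k-1 runs, beginning with 1; conversely, for every
-- such σ and every value y ∈ {2, …, n-1}, there is exactly one gap of σ (with its letters
-- ≥ y shifted up) in which y can be put as a new run start. This accounts for the term
-- (n-2) r(n-2, k-1).

open import Defs
open import Data.Bool using (Bool; true; false; _∧_; T; if_then_else_)
open import Data.Bool.Properties using (T-≡; T-∧; T-not-≡; ∧-assoc; ∧-zeroʳ)
open import Data.Empty using (⊥)
open import Data.List using (List; []; _∷_; _++_; map; length; filterᵇ; concatMap; upTo; applyUpTo)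
open import Data.List.Properties
  using (map-++; map-∘; map-cong; map-injective; map-applyUpTo; length-map; length-++; length-upTo; ∷-injectiveʳ)
open import Data.List.Membership.Propositional using (_∈_; _∉_; find; lose)
open import Data.List.Membership.Propositional.Properties
  using (∈-concatMap⁺; ∈-concatMap⁻; ∈-map⁺; ∈-map⁻; ∈-upTo⁺; ∈-upTo⁻; ∈-filter⁺; ∈-filter⁻; ∈-∃++)
open import Data.List.Membership.Propositional.Properties.WithK using (unique∧set⇒bag)
open import Data.List.Relation.Binary.BagAndSetEquality using (∼bag⇒↭)
open import Data.List.Relation.Binary.Permutation.Propositional using (_↭_)
open import Data.List.Relation.Binary.Permutation.Propositional.Properties using (map⁺)
open import Data.List.Relation.Unary.All using (All; []; _∷_)
import Data.List.Relation.Unary.All as All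
import Data.List.Relation.Unary.All.Properties as AllP
import Data.List.Relation.Unary.AllPairs as AllPairs
open import Data.List.Relation.Unary.Any using (here; there)
open import Data.List.Relation.Unary.Unique.Propositional using (Unique)
import Data.List.Relation.Unary.Unique.Propositional.Properties as Unique
open import Data.Nat using (ℕ; zero; suc; pred; _+_; _*_; _∸_; _≤_; _<_; _≥_; _<ᵇ_; _≡ᵇ_; _≟_; s≤s; z≤n)
open import Data.Nat.ListAction using (sum)
open import Data.Nat.ListAction.Properties using (sum-++; sum-↭)
open import Data.Nat.Properties
open import Algebra.Properties.CommutativeSemigroup +-commutativeSemigroup using (interchange; x∙yz≈y∙xz)
open import Data.List.Membership.DecPropositional _≟_ using (_∈?_)
open import Data.Product using (Σ; _×_; _,_; map₁; map₂; proj₁; proj₂)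
open import Function using (_∘_)
open import Function.Bundles using (Equivalence; mk⇔)
open import Relation.Binary.Definitions using (tri<; tri≈; tri>)
open import Relation.Binary.PropositionalEquality hiding ([_])
open import Data.List.Relation.Binary.Permutation.Setoid (setoid ℕ) using (↭-sym)
open import Data.List.Relation.Binary.Permutation.Setoid.Properties (setoid ℕ) using (Unique-resp-↭; shift)
open import Relation.Nullary using (contradiction; yes; no)
open import Relation.Nullary.Decidable using (T?)
open ≡-Reasoning

𝟙 : Bool → ℕ
𝟙 true  = 1
𝟙 false = 0

𝟙-∧ : ∀ a b → 𝟙 (a ∧ b) ≡ 𝟙 a * 𝟙 b
𝟙-∧ true  b = sym (+-identityʳ (𝟙 b))
𝟙-∧ false b = refl

∑ : {A : Set} → (A → ℕ) → List A → ℕ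
∑ f xs = sum (map f xs)

∑-++ : ∀ {A : Set} (f : A → ℕ) xs ys → ∑ f (xs ++ ys) ≡ ∑ f xs + ∑ f ys
∑-++ f xs ys = trans (cong sum (map-++ f xs ys)) (sum-++ (map f xs) (map f ys))

∑-map : ∀ {A B : Set} (f : B → ℕ) (g : A → B) xs → ∑ f (map g xs) ≡ ∑ (f ∘ g) xs
∑-map f g xs = cong sum (sym (map-∘ xs))

∑-concatMap : ∀ {A B : Set} (f : B → ℕ) (g : A → List B) xs →
              ∑ f (concatMap g xs) ≡ ∑ (∑ f ∘ g) xs
∑-concatMap f g []       = refl
∑-concatMap f g (x ∷ xs) =
  trans (∑-++ f (g x) (concatMap g xs)) (cong (∑ f (g x) +_) (∑-concatMap f g xs))

∑-cong : ∀ {A : Set} {f g : A → ℕ} → (∀ x → f x ≡ g x) → ∀ xs → ∑ f xs ≡ ∑ g xs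
∑-cong f≗g xs = cong sum (map-cong f≗g xs)

∑-cong-∈ : ∀ {A : Set} {f g : A → ℕ} xs → (∀ {x} → x ∈ xs → f x ≡ g x) → ∑ f xs ≡ ∑ g xs
∑-cong-∈ []       f≗g = refl
∑-cong-∈ (x ∷ xs) f≗g = cong₂ _+_ (f≗g (here refl)) (∑-cong-∈ xs (f≗g ∘ there))

∑-zero : ∀ {A : Set} {f : A → ℕ} → (∀ x → f x ≡ 0) → ∀ xs → ∑ f xs ≡ 0
∑-zero         f≗0 []       = refl
∑-zero {f = f} f≗0 (x ∷ xs) = trans (cong (_+ ∑ f xs) (f≗0 x)) (∑-zero f≗0 xs)

∑-+ : ∀ {A : Set} (f g : A → ℕ) xs → ∑ (λ x → f x + g x) xs ≡ ∑ f xs + ∑ g xs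
∑-+ f g []       = refl
∑-+ f g (x ∷ xs) = trans (cong (f x + g x +_) (∑-+ f g xs)) (interchange (f x) (g x) _ _)

∑-*ˡ : ∀ {A : Set} c (f : A → ℕ) xs → ∑ (λ x → c * f x) xs ≡ c * ∑ f xs
∑-*ˡ c f []       = sym (*-zeroʳ c)
∑-*ˡ c f (x ∷ xs) = trans (cong (c * f x +_) (∑-*ˡ c f xs)) (sym (*-distribˡ-+ c (f x) _))

∑-comm : ∀ {A B : Set} (F : A → B → ℕ) xs ys →
         ∑ (λ x → ∑ (F x) ys) xs ≡ ∑ (λ y → ∑ (λ x → F x y) xs) ys
∑-comm F []       ys = sym (∑-zero (λ _ → refl) ys)
∑-comm F (x ∷ xs) ys =
  trans (cong (∑ (F x) ys +_) (∑-comm F xs ys)) (sym (∑-+ (F x) _ ys))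

∑-↭ : ∀ {A : Set} (f : A → ℕ) {xs ys} → xs ↭ ys → ∑ f xs ≡ ∑ f ys
∑-↭ f xs↭ys = sum-↭ (map⁺ f xs↭ys)

length-filterᵇ : ∀ {A : Set} (p : A → Bool) xs → length (filterᵇ p xs) ≡ ∑ (𝟙 ∘ p) xs
length-filterᵇ p []       = refl
length-filterᵇ p (x ∷ xs) with p x
... | true  = cong suc (length-filterᵇ p xs)
... | false = length-filterᵇ p xs

∑-applyUpTo-1 : ∀ (h : ℕ → ℕ) f m → (∀ i → h (f i) ≡ 1) → ∑ h (applyUpTo f m) ≡ m
∑-applyUpTo-1 h f zero    _     = refl
∑-applyUpTo-1 h f (suc m) h∘f≡1 = cong₂ _+_ (h∘f≡1 0) (∑-applyUpTo-1 h (f ∘ suc) m (h∘f≡1 ∘ suc))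

<⇒<ᵇ≡true : ∀ {m n} → m < n → (m <ᵇ n) ≡ true
<⇒<ᵇ≡true m<n = Equivalence.to T-≡ (<⇒<ᵇ m<n)

<ᵇ≡true⇒< : ∀ {m n} → (m <ᵇ n) ≡ true → m < n
<ᵇ≡true⇒< {m} {n} m<ᵇn = <ᵇ⇒< m n (Equivalence.from T-≡ m<ᵇn)

≤⇒<ᵇ≡false : ∀ {m n} → n ≤ m → (m <ᵇ n) ≡ false
≤⇒<ᵇ≡false {m} {n} n≤m with m <ᵇ n in m<ᵇn
... | true  = contradiction (<ᵇ≡true⇒< m<ᵇn) (≤⇒≯ n≤m)
... | false = refl

<ᵇ≡false⇒≤ : ∀ {m n} → (m <ᵇ n) ≡ false → n ≤ m
<ᵇ≡false⇒≤ m<ᵇn≡false = ≮⇒≥ (λ m<n → subst T m<ᵇn≡false (<⇒<ᵇ m<n))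

∧≡true⇒ : ∀ {a b} → a ∧ b ≡ true → a ≡ true × b ≡ true
∧≡true⇒ {true} {true} _ = refl , refl

splits : {A : Set} → List A → List (List A × List A)
splits []      = ([] , []) ∷ []
splits (x ∷ w) = ([] , x ∷ w) ∷ map (map₁ (x ∷_)) (splits w)

focuses : {A : Set} → List A → List (List A × A × List A)
focuses []      = []
focuses (x ∷ w) = ([] , x , w) ∷ map (map₁ (x ∷_)) (focuses w)

∈-splits⁻ : ∀ {A : Set} (w : List A) {a b} → (a , b) ∈ splits w → a ++ b ≡ w
∈-splits⁻ []      (here refl) = refl
∈-splits⁻ (x ∷ w) (here refl) = refl
∈-splits⁻ (x ∷ w) (there p∈) with ∈-map⁻ (map₁ (x ∷_)) p∈
... | _ , p′∈ , refl = cong (x ∷_) (∈-splits⁻ w p′∈)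

∈-splits⁺ : ∀ {A : Set} (a b : List A) → (a , b) ∈ splits (a ++ b)
∈-splits⁺ []      []      = here refl
∈-splits⁺ []      (x ∷ b) = here refl
∈-splits⁺ (x ∷ a) b       = there (∈-map⁺ (map₁ (x ∷_)) (∈-splits⁺ a b))

∈-focuses⁻ : ∀ {A : Set} (w : List A) {a y b} → (a , y , b) ∈ focuses w → a ++ y ∷ b ≡ w
∈-focuses⁻ (x ∷ w) (here refl) = refl
∈-focuses⁻ (x ∷ w) (there t∈) with ∈-map⁻ (map₁ (x ∷_)) t∈
... | _ , t′∈ , refl = cong (x ∷_) (∈-focuses⁻ w t′∈)

∈-focuses⁺ : ∀ {A : Set} (a : List A) y b → (a , y , b) ∈ focuses (a ++ y ∷ b)
∈-focuses⁺ []      y b = here refl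
∈-focuses⁺ (x ∷ a) y b = there (∈-map⁺ (map₁ (x ∷_)) (∈-focuses⁺ a y b))

Unique-∷ : ∀ {A : Set} {x : A} {xs} → x ∉ xs → Unique xs → Unique (x ∷ xs)
Unique-∷ x∉xs xs! = All.tabulate (λ y∈xs x≡y → x∉xs (subst (_∈ _) (sym x≡y) y∈xs)) AllPairs.∷ xs!

map₁-∷-injective : ∀ {A B : Set} {x : A} {p q : List A × B} → map₁ (x ∷_) p ≡ map₁ (x ∷_) q → p ≡ q
map₁-∷-injective {p = _ , _} {q = _ , _} refl = refl

splits-Unique : ∀ {A : Set} (w : List A) → Unique (splits w)
splits-Unique []      = [] AllPairs.∷ AllPairs.[]
splits-Unique (x ∷ w) = Unique-∷ first∉ (Unique.map⁺ map₁-∷-injective (splits-Unique w))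
  where
  first∉ : ([] , x ∷ w) ∉ map (map₁ (x ∷_)) (splits w)
  first∉ p∈ with ∈-map⁻ (map₁ (x ∷_)) p∈
  ... | _ , _ , ()

focuses-Unique : ∀ {A : Set} (w : List A) → Unique (focuses w)
focuses-Unique []      = AllPairs.[]
focuses-Unique (x ∷ w) = Unique-∷ first∉ (Unique.map⁺ map₁-∷-injective (focuses-Unique w))
  where
  first∉ : ([] , x , w) ∉ map (map₁ (x ∷_)) (focuses w)
  first∉ t∈ with ∈-map⁻ (map₁ (x ∷_)) t∈
  ... | _ , _ , ()

∈-concatMap-∃⁻ : ∀ {A B : Set} (f : A → List B) {xs y} →
                 y ∈ concatMap f xs → Σ A λ x → x ∈ xs × y ∈ f x
∈-concatMap-∃⁻ f y∈ = find (∈-concatMap⁻ f y∈)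

∈-concatMap-∃⁺ : ∀ {A B : Set} (f : A → List B) {xs x y} → x ∈ xs → y ∈ f x → y ∈ concatMap f xs
∈-concatMap-∃⁺ f x∈ y∈ = ∈-concatMap⁺ f (lose x∈ y∈)

Unique-concatMap⁺ : ∀ {A B : Set} (f : A → List B) → (∀ x → Unique (f x)) →
  (∀ {x x′ z} → z ∈ f x → z ∈ f x′ → x ≡ x′) → ∀ {xs} → Unique xs → Unique (concatMap f xs)
Unique-concatMap⁺ f f! disjoint {[]}     _                = AllPairs.[]
Unique-concatMap⁺ f f! disjoint {x ∷ xs} (x≢xs AllPairs.∷ xs!) =
  Unique.++⁺ (f! x) (Unique-concatMap⁺ f f! disjoint xs!) apart
  where
  apart : ∀ {z} → z ∈ f x × z ∈ concatMap f xs → ⊥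
  apart (z∈fx , z∈rest) with ∈-concatMap-∃⁻ f z∈rest
  ... | x′ , x′∈xs , z∈fx′ = All.lookup x≢xs x′∈xs (disjoint z∈fx z∈fx′)

∑-sameMembers : ∀ {A : Set} (g : A → ℕ) {xs ys} → Unique xs → Unique ys →
  (∀ {z} → z ∈ xs → z ∈ ys) → (∀ {z} → z ∈ ys → z ∈ xs) → ∑ g xs ≡ ∑ g ys
∑-sameMembers g xs! ys! xs⊆ys ys⊆xs = ∑-↭ g (∼bag⇒↭ (unique∧set⇒bag xs! ys! (mk⇔ xs⊆ys ys⊆xs)))

length-middle : ∀ {A : Set} (a : List A) y b → length (a ++ y ∷ b) ≡ suc (length (a ++ b))
length-middle a y b rewrite length-++ a {y ∷ b} | length-++ a {b} = +-suc (length a) (length b)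

All-middle⁻ : ∀ {P : ℕ → Set} a y b → All P (a ++ y ∷ b) → P y × All P (a ++ b)
All-middle⁻ a y b pab with AllP.++⁻ a pab
... | pa , py ∷ pb = py , AllP.++⁺ pa pb

All-middle⁺ : ∀ {P : ℕ → Set} a {y} b → P y → All P (a ++ b) → All P (a ++ y ∷ b)
All-middle⁺ a b py pab with AllP.++⁻ a pab
... | pa , pb = AllP.++⁺ pa (py ∷ pb)

Unique-middle⁻ : ∀ a y b → Unique (a ++ y ∷ b) → All (y ≢_) (a ++ b) × Unique (a ++ b)
Unique-middle⁻ a y b ayb! with Unique-resp-↭ (shift refl a b) ayb!
... | y≢ab AllPairs.∷ ab! = y≢ab , ab!

Unique-middle⁺ : ∀ a y b → All (y ≢_) (a ++ b) → Unique (a ++ b) → Unique (a ++ y ∷ b)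
Unique-middle⁺ a y b y≢ab ab! = Unique-resp-↭ (↭-sym (shift refl a b)) (y≢ab AllPairs.∷ ab!)

∈-middle-≢ : ∀ {z x : ℕ} a b → z ∈ a ++ x ∷ b → z ≢ x → z ∈ a ++ b
∈-middle-≢ []      b (here refl)  z≢x = contradiction refl z≢x
∈-middle-≢ []      b (there z∈b)  z≢x = z∈b
∈-middle-≢ (y ∷ a) b (here refl)  z≢x = here refl
∈-middle-≢ (y ∷ a) b (there z∈ab) z≢x = there (∈-middle-≢ a b z∈ab z≢x)

length-≤-Unique⊆ : ∀ w S → Unique w → All (_∈ S) w → length w ≤ length S
length-≤-Unique⊆ []      S _                    _              = z≤n
length-≤-Unique⊆ (x ∷ w) S (x≢w AllPairs.∷ w!) (x∈S ∷ w⊆S) with ∈-∃++ x∈S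
... | S₁ , S₂ , refl = subst (suc (length w) ≤_) (sym (length-middle S₁ x S₂))
  (s≤s (length-≤-Unique⊆ w (S₁ ++ S₂) w!
         (All.zipWith (λ (z∈S , x≢z) → ∈-middle-≢ S₁ S₂ z∈S (≢-sym x≢z)) (w⊆S , x≢w))))

occurrences : ℕ → List ℕ → ℕ
occurrences n = ∑ (𝟙 ∘ (_≡ᵇ n))

occurrences-∉ : ∀ n w → All (n ≢_) w → occurrences n w ≡ 0
occurrences-∉ n []      []            = refl
occurrences-∉ n (y ∷ w) (n≢y ∷ n≢w) with y ≡ᵇ n in y≡ᵇn
... | true  = contradiction (sym (≡ᵇ⇒≡ y n (Equivalence.from T-≡ y≡ᵇn))) n≢y
... | false = occurrences-∉ n w n≢w

occurrences-Unique : ∀ n w → Unique w → n ∈ w → occurrences n w ≡ 1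
occurrences-Unique n (x ∷ w) (x≢w AllPairs.∷ _) (here refl)
  rewrite Equivalence.to T-≡ (≡⇒≡ᵇ x x refl) = cong suc (occurrences-∉ x w x≢w)
occurrences-Unique n (x ∷ w) (x≢w AllPairs.∷ w!) (there n∈w) with x ≡ᵇ n in x≡ᵇn
... | true  = contradiction (≡ᵇ⇒≡ x n (Equivalence.from T-≡ x≡ᵇn)) (All.lookup x≢w n∈w)
... | false = occurrences-Unique n w w! n∈w

∑-𝟙≡ᵇ : ∀ n (F : ℕ → ℕ) xs → ∑ (λ x → 𝟙 (x ≡ᵇ n) * F x) xs ≡ occurrences n xs * F n
∑-𝟙≡ᵇ n F []       = refl
∑-𝟙≡ᵇ n F (x ∷ xs) with x ≡ᵇ n in x≡ᵇn
... | true  rewrite ≡ᵇ⇒≡ x n (Equivalence.from T-≡ x≡ᵇn) =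
  trans (cong (F n + 0 +_) (∑-𝟙≡ᵇ n F xs)) (sym (*-distribʳ-+ (F n) 1 (occurrences n xs)))
... | false = ∑-𝟙≡ᵇ n F xs

∑-focuses-𝟙≡ᵇ : ∀ n (G : List ℕ → ℕ) τ →
  ∑ (λ (a , y , b) → 𝟙 (y ≡ᵇ n) * G (a ++ y ∷ b)) (focuses τ) ≡ occurrences n τ * G τ
∑-focuses-𝟙≡ᵇ n G []      = refl
∑-focuses-𝟙≡ᵇ n G (x ∷ τ)
  rewrite ∑-map (λ (a , y , b) → 𝟙 (y ≡ᵇ n) * G (a ++ y ∷ b)) (map₁ (x ∷_)) (focuses τ)
        | ∑-focuses-𝟙≡ᵇ n (G ∘ (x ∷_)) τ
  = sym (*-distribʳ-+ (G (x ∷ τ)) (𝟙 (x ≡ᵇ n)) (occurrences n τ))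

-- Run starts

startsAfter : ℕ → List ℕ → List ℕ
startsAfter l []      = []
startsAfter l (y ∷ w) = if l <ᵇ y then startsAfter y w else y ∷ startsAfter y w

starts : List ℕ → List ℕ
starts []      = []
starts (x ∷ w) = x ∷ startsAfter x w

lastFrom : ℕ → List ℕ → ℕ
lastFrom l []      = l
lastFrom l (y ∷ w) = lastFrom y w

increasingOfLength : ℕ → List ℕ → Bool
increasingOfLength k L = increasing L ∧ (length L ≡ᵇ k)

runSortedWith : ℕ → List ℕ → Bool
runSortedWith k w = increasingOfLength k (starts w)

runs-∷ : ∀ x w → Σ (List ℕ) λ run → Σ (List (List ℕ)) λ rest →
         runs (x ∷ w) ≡ (x ∷ run) ∷ rest × minL (x ∷ run) ≡ x × map minL rest ≡ startsAfter x w
runs-∷ x []      = [] , [] , refl , refl , refl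
runs-∷ x (y ∷ w) with runs-∷ y w
... | run , rest , runs≡ , minL≡ , rest≡ with x <ᵇ y in x<ᵇy
...   | true  = y ∷ run , rest , runs≡′ , minL≡′ , rest≡
  where
  runs≡′ : runs (x ∷ y ∷ w) ≡ (x ∷ y ∷ run) ∷ rest
  runs≡′ rewrite runs≡ | x<ᵇy = refl
  minL≡′ : minL (x ∷ y ∷ run) ≡ x
  minL≡′ rewrite minL≡ | x<ᵇy = refl
...   | false = [] , (y ∷ run) ∷ rest , runs≡′ , refl , cong₂ _∷_ minL≡ rest≡
  where
  runs≡′ : runs (x ∷ y ∷ w) ≡ (x ∷ []) ∷ (y ∷ run) ∷ rest
  runs≡′ rewrite runs≡ | x<ᵇy = refl

map-minL-runs : ∀ w → map minL (runs w) ≡ starts w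
map-minL-runs []      = refl
map-minL-runs (x ∷ w) with runs-∷ x w
... | _ , _ , runs≡ , minL≡ , rest≡ rewrite runs≡ = cong₂ _∷_ minL≡ rest≡

runSorted∧runs≡runSortedWith : ∀ k w →
  (runSorted w ∧ (length (runs w) ≡ᵇ k)) ≡ runSortedWith k w
runSorted∧runs≡runSortedWith k w
  rewrite sym (length-map minL (runs w)) | map-minL-runs w = refl

r≡∑runSortedWith : ∀ n k → r n k ≡ ∑ (𝟙 ∘ runSortedWith k) (perms n)
r≡∑runSortedWith n k =
  trans (length-filterᵇ _ (perms n)) (∑-cong (cong 𝟙 ∘ runSorted∧runs≡runSortedWith k) (perms n))

All-startsAfter : ∀ {P : ℕ → Set} l w → All P w → All P (startsAfter l w)
All-startsAfter l []      []         = []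
All-startsAfter l (y ∷ w) (py ∷ pw) with l <ᵇ y
... | true  = All-startsAfter y w pw
... | false = py ∷ All-startsAfter y w pw

increasing∷startsAfter⇒All≥ : ∀ s l w → increasing (s ∷ startsAfter l w) ≡ true → s ≤ l → All (s ≤_) w
increasing∷startsAfter⇒All≥ s l []      _   _   = []
increasing∷startsAfter⇒All≥ s l (y ∷ w) inc s≤l with l <ᵇ y in l<ᵇy
... | true  = s≤y ∷ increasing∷startsAfter⇒All≥ s y w inc s≤y
  where
  s≤y : s ≤ y
  s≤y = ≤-trans s≤l (<⇒≤ (<ᵇ≡true⇒< l<ᵇy))
... | false with ∧≡true⇒ inc
...   | s<ᵇy , inc′ =
  <⇒≤ s<y ∷ All.map (≤-trans (<⇒≤ s<y)) (increasing∷startsAfter⇒All≥ y y w inc′ ≤-refl)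
  where
  s<y : s < y
  s<y = <ᵇ≡true⇒< s<ᵇy

increasing-∷-++-∷⇒< : ∀ s L v M → increasing (s ∷ L ++ v ∷ M) ≡ true → s < v
increasing-∷-++-∷⇒< s []      v M inc = <ᵇ≡true⇒< (proj₁ (∧≡true⇒ inc))
increasing-∷-++-∷⇒< s (x ∷ L) v M inc with ∧≡true⇒ inc
... | s<ᵇx , inc′ = <-trans (<ᵇ≡true⇒< s<ᵇx) (increasing-∷-++-∷⇒< x L v M inc′)

length*𝟙-increasingOfLength : ∀ k L →
  length L * 𝟙 (increasingOfLength k L) ≡ k * 𝟙 (increasingOfLength k L)
length*𝟙-increasingOfLength k L with increasing L | length L ≡ᵇ k in |L|≡ᵇk
... | true  | true  = cong (_* 1) (≡ᵇ⇒≡ (length L) k (Equivalence.from T-≡ |L|≡ᵇk))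
... | true  | false = trans (*-zeroʳ (length L)) (sym (*-zeroʳ k))
... | false | _     = trans (*-zeroʳ (length L)) (sym (*-zeroʳ k))

headBelow : ℕ → List ℕ → Bool
headBelow v []      = false
headBelow v (z ∷ _) = z <ᵇ v

𝟙-increasing-∷-by-head : ∀ {s v} (L : List ℕ) E → s < v → All (_≢ v) L →
  𝟙 (increasing (v ∷ L) ∧ E) + 𝟙 (increasing (s ∷ L) ∧ headBelow v L ∧ E)
    ≡ 𝟙 (increasing (s ∷ L) ∧ E)
𝟙-increasing-∷-by-head []      E s<v []         = +-identityʳ _
𝟙-increasing-∷-by-head {s} {v} (z ∷ L) E s<v (z≢v ∷ _) with <-cmp z v
... | tri< z<v _ _ rewrite ≤⇒<ᵇ≡false {v} {z} (<⇒≤ z<v) | <⇒<ᵇ≡true z<v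
  with s <ᵇ z | increasing (z ∷ L)
...   | true  | true  = refl
...   | true  | false = refl
...   | false | _     = refl
𝟙-increasing-∷-by-head (z ∷ L) E s<v (z≢v ∷ _) | tri≈ _ z≡v _ = contradiction z≡v z≢v
𝟙-increasing-∷-by-head (z ∷ L) E s<v (z≢v ∷ _) | tri> _ _ v<z
  rewrite <⇒<ᵇ≡true v<z | ≤⇒<ᵇ≡false (<⇒≤ v<z) | <⇒<ᵇ≡true (<-trans s<v v<z)
  with increasing (z ∷ L)
... | true  = +-identityʳ _
... | false = refl

-- Inserting the maximal letter

∑-splits-insert-max : ∀ {n} (G : List ℕ → ℕ) l w → l < n → All (_< n) w →
  ∑ (λ (a , b) → G (startsAfter l (a ++ n ∷ b))) (splits w)
    ≡ suc (length (startsAfter l w)) * G (startsAfter l w)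
      + ∑ (λ (a , y , b) → 𝟙 (lastFrom l a <ᵇ y) * G (startsAfter l a ++ y ∷ startsAfter y b)) (focuses w)
∑-splits-insert-max G l [] l<n [] rewrite <⇒<ᵇ≡true l<n = sym (+-identityʳ _)
∑-splits-insert-max {n} G l (y ∷ w) l<n (y<n ∷ w<n)
  rewrite ∑-map (λ (a , b) → G (startsAfter l (a ++ n ∷ b))) (map₁ (y ∷_)) (splits w)
        | ∑-map (λ (a , z , b) → 𝟙 (lastFrom l a <ᵇ z) * G (startsAfter l a ++ z ∷ startsAfter z b))
                (map₁ (y ∷_)) (focuses w)
        | <⇒<ᵇ≡true l<n | ≤⇒<ᵇ≡false {n} (<⇒≤ y<n)
  with l <ᵇ y
... | true  = trans (cong (G (y ∷ S) +_) (∑-splits-insert-max G y w y<n w<n))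
                    (x∙yz≈y∙1*x∙z (G (y ∷ S)) (suc (length S) * G S) _)
  where
  S : List ℕ
  S = startsAfter y w
  x∙yz≈y∙1*x∙z : ∀ a b c → a + (b + c) ≡ b + (1 * a + c)
  x∙yz≈y∙1*x∙z a b c rewrite *-identityˡ a = x∙yz≈y∙xz a b c
... | false = trans (cong (G (y ∷ startsAfter y w) +_) (∑-splits-insert-max (G ∘ (y ∷_)) y w y<n w<n))
                    (sym (+-assoc (G (y ∷ startsAfter y w)) _ _))

-- (a , y , b) stands for the gap of a ++ y ∷ b just before y. If y continues the run of the
-- last letter of a, inserting the maximal letter into this gap makes y a new run start;
-- newRunAt k tests whether the result is run-sorted with k runs. The front gap never qualifies.
newRunAt : ℕ → List ℕ × ℕ × List ℕ → ℕ
newRunAt k ([]    , y , b) = 0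
newRunAt k (x ∷ a , y , b) =
  𝟙 ((lastFrom x a <ᵇ y) ∧ increasingOfLength k (x ∷ startsAfter x a ++ y ∷ startsAfter y b))

runSortedWith-max∷ : ∀ {n} k x τ → x < n → runSortedWith k (n ∷ x ∷ τ) ≡ false
runSortedWith-max∷ {n} k x τ x<n
  rewrite ≤⇒<ᵇ≡false {n} (<⇒≤ x<n) | ≤⇒<ᵇ≡false {n} (<⇒≤ x<n) = refl

∑-splits-insert-max-runSortedWith : ∀ {n} k x τ → x < n → All (_< n) τ →
  ∑ (λ (a , b) → 𝟙 (runSortedWith k (a ++ n ∷ b))) (splits (x ∷ τ))
    ≡ k * 𝟙 (runSortedWith k (x ∷ τ)) + ∑ (newRunAt k) (focuses (x ∷ τ))
∑-splits-insert-max-runSortedWith {n} k x τ x<n τ<n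
  rewrite ∑-map (λ (a , b) → 𝟙 (runSortedWith k (a ++ n ∷ b))) (map₁ (x ∷_)) (splits τ)
        | ∑-map (newRunAt k) (map₁ (x ∷_)) (focuses τ)
        | runSortedWith-max∷ k x τ x<n
  = trans (∑-splits-insert-max (𝟙 ∘ increasingOfLength k ∘ (x ∷_)) x τ x<n τ<n)
          (cong₂ _+_ (length*𝟙-increasingOfLength k (starts (x ∷ τ)))
                     (∑-cong (λ (a , y , b) → sym (𝟙-∧ (lastFrom x a <ᵇ y) _)) (focuses τ)))

-- Inserting a new run start

module InsertRunStart (v : ℕ) where

  -- Tests whether v, put between a and b right after a smaller letter, becomes a run start
  -- such that the run starts form an increasing list; s is the last run start before a,
  -- l the letter just before a, and P constrains the number of run starts from a on.
  newStartAt : (ℕ → Bool) → ℕ → ℕ → List ℕ × List ℕ → ℕ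
  newStartAt P s l (a , b) = 𝟙 ((lastFrom l a <ᵇ v) ∧ increasing (s ∷ L) ∧ P (length L))
    where L = startsAfter l a ++ v ∷ startsAfter v b

  newStartAt-≡0 : ∀ P {s} l p → v < s → newStartAt P s l p ≡ 0
  newStartAt-≡0 P {s} l (a , b) v<s
    with increasing (s ∷ startsAfter l a ++ v ∷ startsAfter v b) in inc
  ... | true  = contradiction (increasing-∷-++-∷⇒< s (startsAfter l a) v _ inc) (<⇒≯ v<s)
  ... | false with lastFrom l a <ᵇ v
  ...   | true  = refl
  ...   | false = refl

  newStartAt-[]-below : ∀ P s l y w → y < v → newStartAt P s l ([] , y ∷ w) ≡ 0
  newStartAt-[]-below P s l y w y<v
    rewrite ≤⇒<ᵇ≡false {v} (<⇒≤ y<v) | ≤⇒<ᵇ≡false {v} (<⇒≤ y<v) with l <ᵇ v | s <ᵇ v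
  ... | true  | true  = refl
  ... | true  | false = refl
  ... | false | _     = refl

  newStartAt-[]-above : ∀ P {s l} y w → s < v → l < v → v < y →
    newStartAt P s l ([] , y ∷ w) ≡ 𝟙 (increasing (v ∷ startsAfter y w) ∧ P (suc (length (startsAfter y w))))
  newStartAt-[]-above P y w s<v l<v v<y
    rewrite <⇒<ᵇ≡true l<v | <⇒<ᵇ≡true v<y | <⇒<ᵇ≡true s<v = refl

  newStartAt-[]-behind : ∀ P s {l} b → v < l → newStartAt P s l ([] , b) ≡ 0
  newStartAt-[]-behind P s b v<l rewrite ≤⇒<ᵇ≡false (<⇒≤ v<l) = refl

  newStartAt-∷ : ∀ P s l y p →
    newStartAt P s l (map₁ (y ∷_) p)
      ≡ (if l <ᵇ y then newStartAt P s y p else 𝟙 (s <ᵇ y) * newStartAt (P ∘ suc) y y p)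
  newStartAt-∷ P s l y (a , b) with l <ᵇ y
  ... | true = refl
  ... | false with lastFrom y a <ᵇ v
  ...   | false = sym (*-zeroʳ (𝟙 (s <ᵇ y)))
  ...   | true with s <ᵇ y
  ...     | true  = sym (+-identityʳ _)
  ...     | false = refl

  ∑-newStartAt-splits-∷ : ∀ P s l y w →
    ∑ (newStartAt P s l) (splits (y ∷ w))
      ≡ newStartAt P s l ([] , y ∷ w)
        + (if l <ᵇ y then ∑ (newStartAt P s y) (splits w)
                     else 𝟙 (s <ᵇ y) * ∑ (newStartAt (P ∘ suc) y y) (splits w))
  ∑-newStartAt-splits-∷ P s l y w = cong (newStartAt P s l ([] , y ∷ w) +_)
    (trans (∑-map _ (map₁ (y ∷_)) (splits w))
           (trans (∑-cong (newStartAt-∷ P s l y) (splits w)) (∑-if (l <ᵇ y))))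
    where
    ∑-if : ∀ c →
      ∑ (λ p → if c then newStartAt P s y p else 𝟙 (s <ᵇ y) * newStartAt (P ∘ suc) y y p) (splits w)
        ≡ (if c then ∑ (newStartAt P s y) (splits w)
                else 𝟙 (s <ᵇ y) * ∑ (newStartAt (P ∘ suc) y y) (splits w))
    ∑-if true  = refl
    ∑-if false = ∑-*ˡ (𝟙 (s <ᵇ y)) _ (splits w)

  𝟙-increasing-∷∷ : ∀ s y L E →
    𝟙 (s <ᵇ y) * 𝟙 (increasing (y ∷ L) ∧ E) ≡ 𝟙 (increasing (s ∷ y ∷ L) ∧ E)
  𝟙-increasing-∷∷ s y L E = trans (sym (𝟙-∧ (s <ᵇ y) _)) (cong 𝟙 (sym (∧-assoc (s <ᵇ y) _ E)))

  mutual
    ∑-newStartAt-ahead : ∀ P s l w → s < v → l < v → All (_≢ v) w →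
      ∑ (newStartAt P s l) (splits w)
        ≡ 𝟙 (increasing (s ∷ startsAfter l w) ∧ P (suc (length (startsAfter l w))))
    ∑-newStartAt-ahead P s l [] s<v l<v [] rewrite <⇒<ᵇ≡true l<v | <⇒<ᵇ≡true s<v = +-identityʳ _
    ∑-newStartAt-ahead P s l (y ∷ w) s<v l<v (y≢v ∷ w≢v) rewrite ∑-newStartAt-splits-∷ P s l y w
      with l <ᵇ y in l<ᵇy
    ... | true with <-cmp y v
    ...   | tri< y<v _ _ = cong₂ _+_ (newStartAt-[]-below P s l y w y<v)
                             (∑-newStartAt-ahead P s y w s<v y<v w≢v)
    ...   | tri≈ _ y≡v _ = contradiction y≡v y≢v
    ...   | tri> _ _ v<y = trans (cong₂ _+_ (newStartAt-[]-above P y w s<v l<v v<y)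
                                      (∑-newStartAt-behind P s y w s<v v<y w≢v))
                               (𝟙-increasing-∷-by-head (startsAfter y w) _ s<v (All-startsAfter y w w≢v))
    ∑-newStartAt-ahead P s l (y ∷ w) s<v l<v (y≢v ∷ w≢v) | false =
      cong₂ _+_ (newStartAt-[]-below P s l y w y<v)
        (begin
          𝟙 (s <ᵇ y) * ∑ (newStartAt (P ∘ suc) y y) (splits w)
        ≡⟨ cong (𝟙 (s <ᵇ y) *_) (∑-newStartAt-ahead (P ∘ suc) y y w y<v y<v w≢v) ⟩
          𝟙 (s <ᵇ y) * 𝟙 (increasing (y ∷ startsAfter y w) ∧ P (suc (suc (length (startsAfter y w)))))
        ≡⟨ 𝟙-increasing-∷∷ s y (startsAfter y w) _ ⟩
          𝟙 (increasing (s ∷ y ∷ startsAfter y w) ∧ P (suc (suc (length (startsAfter y w)))))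
        ∎)
      where
      y<v : y < v
      y<v = ≤-<-trans (<ᵇ≡false⇒≤ l<ᵇy) l<v

    ∑-newStartAt-behind : ∀ P s l w → s < v → v < l → All (_≢ v) w →
      ∑ (newStartAt P s l) (splits w)
        ≡ 𝟙 (increasing (s ∷ startsAfter l w) ∧ headBelow v (startsAfter l w)
             ∧ P (suc (length (startsAfter l w))))
    ∑-newStartAt-behind P s l [] s<v v<l [] rewrite ≤⇒<ᵇ≡false (<⇒≤ v<l) = refl
    ∑-newStartAt-behind P s l (y ∷ w) s<v v<l (y≢v ∷ w≢v) rewrite ∑-newStartAt-splits-∷ P s l y w
      with l <ᵇ y in l<ᵇy
    ... | true = cong₂ _+_ (newStartAt-[]-behind P s (y ∷ w) v<l)
                   (∑-newStartAt-behind P s y w s<v (<-trans v<l (<ᵇ≡true⇒< l<ᵇy)) w≢v)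
    ... | false = cong₂ _+_ (newStartAt-[]-behind P s (y ∷ w) v<l)
                    new-start-y
      where
      new-start-y : 𝟙 (s <ᵇ y) * ∑ (newStartAt (P ∘ suc) y y) (splits w)
        ≡ 𝟙 (increasing (s ∷ y ∷ startsAfter y w) ∧ (y <ᵇ v) ∧ P (suc (suc (length (startsAfter y w)))))
      new-start-y with <-cmp y v
      ... | tri< y<v _ _ rewrite <⇒<ᵇ≡true y<v =
        trans (cong (𝟙 (s <ᵇ y) *_) (∑-newStartAt-ahead (P ∘ suc) y y w y<v y<v w≢v))
              (𝟙-increasing-∷∷ s y (startsAfter y w) _)
      ... | tri≈ _ y≡v _ = contradiction y≡v y≢v
      ... | tri> _ _ v<y rewrite ≤⇒<ᵇ≡false (<⇒≤ v<y) =
        trans (cong (𝟙 (s <ᵇ y) *_) (∑-zero (λ p → newStartAt-≡0 (P ∘ suc) y p v<y) (splits w)))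
              (trans (*-zeroʳ (𝟙 (s <ᵇ y))) (cong 𝟙 (sym (∧-zeroʳ (increasing (s ∷ y ∷ startsAfter y w))))))

∑-newRunAt : ∀ k v x σ → All (_≢ v) (x ∷ σ) →
  ∑ (λ (a , b) → newRunAt (suc k) (a , v , b)) (splits (x ∷ σ))
    ≡ 𝟙 (x <ᵇ v) * 𝟙 (runSortedWith k (x ∷ σ))
∑-newRunAt k v x σ (x≢v ∷ σ≢v)
  rewrite ∑-map (λ (a , b) → newRunAt (suc k) (a , v , b)) (map₁ (x ∷_)) (splits σ)
  with <-cmp x v
... | tri< x<v _ _ rewrite <⇒<ᵇ≡true x<v =
  trans (∑-newStartAt-ahead (_≡ᵇ k) x x σ x<v x<v σ≢v) (sym (+-identityʳ _))
  where open InsertRunStart v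
... | tri≈ _ x≡v _ = contradiction x≡v x≢v
... | tri> _ _ v<x rewrite ≤⇒<ᵇ≡false (<⇒≤ v<x) =
  ∑-zero (λ p → newStartAt-≡0 (_≡ᵇ k) x p v<x) (splits σ)
  where open InsertRunStart v

-- Permutations of [n]

∈-words⁻ : ∀ m as {w} → w ∈ words m as → length w ≡ m × All (_∈ as) w
∈-words⁻ zero    as (here refl) = refl , []
∈-words⁻ (suc m) as w∈ with ∈-concatMap-∃⁻ (λ a → map (a ∷_) (words m as)) {xs = as} w∈
... | a , a∈ , w∈′ with ∈-map⁻ (a ∷_) w∈′
... | w′ , w′∈ , refl with ∈-words⁻ m as w′∈
... | |w′|≡m , w′⊆as = cong suc |w′|≡m , a∈ ∷ w′⊆as

∈-words⁺ : ∀ m as w → length w ≡ m → All (_∈ as) w → w ∈ words m as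
∈-words⁺ zero    as []      _     []            = here refl
∈-words⁺ (suc m) as (a ∷ w) |w|≡m (a∈ ∷ w⊆as) =
  ∈-concatMap-∃⁺ (λ a → map (a ∷_) (words m as)) a∈
    (∈-map⁺ (a ∷_) (∈-words⁺ m as w (suc-injective |w|≡m) w⊆as))

words-Unique : ∀ m as → Unique as → Unique (words m as)
words-Unique zero    as _   = [] AllPairs.∷ AllPairs.[]
words-Unique (suc m) as as! =
  Unique-concatMap⁺ (λ a → map (a ∷_) (words m as))
    (λ a → Unique.map⁺ ∷-injectiveʳ (words-Unique m as as!)) disjoint as!
  where
  disjoint : ∀ {x x′ w} → w ∈ map (x ∷_) (words m as) → w ∈ map (x′ ∷_) (words m as) → x ≡ x′
  disjoint {x} {x′} w∈ w∈′ with ∈-map⁻ (x ∷_) w∈ | ∈-map⁻ (x′ ∷_) w∈′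
  ... | _ , _ , refl | _ , _ , refl = refl

notIn⇒All≢ : ∀ x w → T (notIn x w) → All (x ≢_) w
notIn⇒All≢ x []      _        = []
notIn⇒All≢ x (y ∷ w) x∉y∷w with Equivalence.to T-∧ x∉y∷w
... | x≢ᵇy , x∉w =
  (λ x≡y → subst T (Equivalence.to T-not-≡ x≢ᵇy) (≡⇒≡ᵇ x y x≡y)) ∷ notIn⇒All≢ x w x∉w

All≢⇒notIn : ∀ x w → All (x ≢_) w → T (notIn x w)
All≢⇒notIn x []      []            = _
All≢⇒notIn x (y ∷ w) (x≢y ∷ x≢w) = Equivalence.from T-∧
  (Equivalence.from T-not-≡ (≢⇒≡ᵇ≡false x≢y) , All≢⇒notIn x w x≢w)
  where
  ≢⇒≡ᵇ≡false : x ≢ y → (x ≡ᵇ y) ≡ false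
  ≢⇒≡ᵇ≡false x≢y with x ≡ᵇ y in x≡ᵇy
  ... | true  = contradiction (≡ᵇ⇒≡ x y (Equivalence.from T-≡ x≡ᵇy)) x≢y
  ... | false = refl

distinct⇒Unique : ∀ w → T (distinct w) → Unique w
distinct⇒Unique []      _ = AllPairs.[]
distinct⇒Unique (x ∷ w) d with Equivalence.to T-∧ d
... | x∉w , w! = notIn⇒All≢ x w x∉w AllPairs.∷ distinct⇒Unique w w!

Unique⇒distinct : ∀ w → Unique w → T (distinct w)
Unique⇒distinct []      _                   = _
Unique⇒distinct (x ∷ w) (x≢w AllPairs.∷ w!) =
  Equivalence.from T-∧ (All≢⇒notIn x w x≢w , Unique⇒distinct w w!)

bump : ℕ → ℕ → ℕ
bump v z = if z <ᵇ v then z else suc z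

unbump : ℕ → ℕ → ℕ
unbump v z = if z <ᵇ v then z else pred z

bump-<ᵇ : ∀ v x z → (bump v x <ᵇ bump v z) ≡ (x <ᵇ z)
bump-<ᵇ v x z with x <ᵇ v in x<ᵇv | z <ᵇ v in z<ᵇv
... | true  | true  = refl
... | false | false = refl
... | true  | false = trans (<⇒<ᵇ≡true (m<n⇒m<1+n x<z)) (sym (<⇒<ᵇ≡true x<z))
  where
  x<z : x < z
  x<z = <-≤-trans (<ᵇ≡true⇒< {n = v} x<ᵇv) (<ᵇ≡false⇒≤ z<ᵇv)
... | false | true  = trans (≤⇒<ᵇ≡false (m≤n⇒m≤1+n z≤x)) (sym (≤⇒<ᵇ≡false z≤x))
  where
  z≤x : z ≤ x
  z≤x = <⇒≤ (<-≤-trans (<ᵇ≡true⇒< {n = v} z<ᵇv) (<ᵇ≡false⇒≤ x<ᵇv))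

bump-injective : ∀ v {x z} → bump v x ≡ bump v z → x ≡ z
bump-injective v bx≡bz = ≤-antisym (<ᵇ≡false⇒≤ (≮ᵇ bx≡bz)) (<ᵇ≡false⇒≤ (≮ᵇ (sym bx≡bz)))
  where
  ≮ᵇ : ∀ {a c} → bump v a ≡ bump v c → (c <ᵇ a) ≡ false
  ≮ᵇ {a} {c} ba≡bc =
    trans (sym (bump-<ᵇ v c a)) (trans (cong (bump v c <ᵇ_) ba≡bc) (≤⇒<ᵇ≡false {bump v c} ≤-refl))

bump-≢ : ∀ v z → bump v z ≢ v
bump-≢ v z with z <ᵇ v in z<ᵇv
... | true  = <⇒≢ (<ᵇ≡true⇒< z<ᵇv)
... | false = λ z+1≡v → <-irrefl (sym z+1≡v) (s≤s (<ᵇ≡false⇒≤ z<ᵇv))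

All-bump-≢ : ∀ v w → All (_≢ v) (map (bump v) w)
All-bump-≢ v []      = []
All-bump-≢ v (z ∷ w) = bump-≢ v z ∷ All-bump-≢ v w

bump-<ᵇ-self : ∀ v x → (bump v x <ᵇ v) ≡ (x <ᵇ v)
bump-<ᵇ-self v x with x <ᵇ v in x<ᵇv
... | true  = x<ᵇv
... | false = ≤⇒<ᵇ≡false (m≤n⇒m≤1+n (<ᵇ≡false⇒≤ {x} {v} x<ᵇv))

bump-unbump : ∀ v z → v ≢ z → bump v (unbump v z) ≡ z
bump-unbump v z v≢z with z <ᵇ v in z<ᵇv
... | true rewrite z<ᵇv = refl
bump-unbump v zero    v≢z | false = contradiction (n≤0⇒n≡0 (<ᵇ≡false⇒≤ z<ᵇv)) v≢z
bump-unbump v (suc z) v≢z | false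
  rewrite ≤⇒<ᵇ≡false {z} {v} (≤-pred (≤∧≢⇒< (<ᵇ≡false⇒≤ z<ᵇv) v≢z)) = refl

map-bump-unbump : ∀ v w → All (v ≢_) w → map (bump v) (map (unbump v) w) ≡ w
map-bump-unbump v []      []            = refl
map-bump-unbump v (z ∷ w) (v≢z ∷ v≢w) = cong₂ _∷_ (bump-unbump v z v≢z) (map-bump-unbump v w v≢w)

map-bump-below : ∀ v ρ → All (_< v) ρ → map (bump v) ρ ≡ ρ
map-bump-below v []      []            = refl
map-bump-below v (z ∷ ρ) (z<v ∷ ρ<v) rewrite <⇒<ᵇ≡true z<v = cong (z ∷_) (map-bump-below v ρ ρ<v)

increasing-bump : ∀ v L → increasing (map (bump v) L) ≡ increasing L
increasing-bump v []          = refl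
increasing-bump v (x ∷ [])    = refl
increasing-bump v (x ∷ y ∷ L) = cong₂ _∧_ (bump-<ᵇ v x y) (increasing-bump v (y ∷ L))

startsAfter-bump : ∀ v l w → startsAfter (bump v l) (map (bump v) w) ≡ map (bump v) (startsAfter l w)
startsAfter-bump v l []      = refl
startsAfter-bump v l (y ∷ w) rewrite bump-<ᵇ v l y with l <ᵇ y
... | true  = startsAfter-bump v y w
... | false = cong (bump v y ∷_) (startsAfter-bump v y w)

starts-bump : ∀ v w → starts (map (bump v) w) ≡ map (bump v) (starts w)
starts-bump v []      = refl
starts-bump v (x ∷ w) = cong (bump v x ∷_) (startsAfter-bump v x w)

runSortedWith-bump : ∀ k v w → runSortedWith k (map (bump v) w) ≡ runSortedWith k w
runSortedWith-bump k v w rewrite starts-bump v w | increasing-bump v (starts w)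
                              | length-map (bump v) (starts w) = refl

∈-range⁺ : ∀ {m z} → 1 ≤ z → z ≤ m → z ∈ [ m ]
∈-range⁺ {z = suc z} _ z<m = ∈-map⁺ suc (∈-upTo⁺ z<m)

∈-range⁻ : ∀ {m z} → z ∈ [ m ] → 1 ≤ z × z ≤ m
∈-range⁻ z∈ with ∈-map⁻ suc z∈
... | _ , i∈ , refl = s≤s z≤n , ∈-upTo⁻ i∈

range-Unique : ∀ m → Unique [ m ]
range-Unique m = Unique.map⁺ suc-injective (Unique.upTo⁺ m)

length-range : ∀ m → length [ m ] ≡ m
length-range m = trans (length-map suc (upTo m)) (length-upTo m)

bump-range : ∀ {m} v z → z ∈ [ m ] → bump v z ∈ [ suc m ]
bump-range v z z∈ with ∈-range⁻ z∈ | z <ᵇ v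
... | 1≤z , z≤m | true  = ∈-range⁺ 1≤z (m≤n⇒m≤1+n z≤m)
... | 1≤z , z≤m | false = ∈-range⁺ (s≤s z≤n) (s≤s z≤m)

unbump-range : ∀ {m} v z → v ∈ [ suc m ] → z ∈ [ suc m ] → v ≢ z → unbump v z ∈ [ m ]
unbump-range v z v∈ z∈ v≢z with ∈-range⁻ v∈ | ∈-range⁻ z∈ | z <ᵇ v in z<ᵇv
... | _ , v≤m+1 | 1≤z , _ | true = ∈-range⁺ 1≤z (≤-pred (≤-trans (<ᵇ≡true⇒< z<ᵇv) v≤m+1))
unbump-range v (suc z) _ _ v≢z | 1≤v , _ | _ , z<m+1 | false =
  ∈-range⁺ (≤-trans 1≤v (≤-pred (≤∧≢⇒< (<ᵇ≡false⇒≤ z<ᵇv) v≢z))) (≤-pred z<m+1)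

IsPerm : ℕ → List ℕ → Set
IsPerm m w = length w ≡ m × All (_∈ [ m ]) w × Unique w

∈-perms⁻ : ∀ m {w} → w ∈ perms m → IsPerm m w
∈-perms⁻ m {w} w∈ with ∈-filter⁻ (T? ∘ distinct) w∈
... | w∈words , w-distinct with ∈-words⁻ m [ m ] w∈words
... | |w|≡m , w⊆[m] = |w|≡m , w⊆[m] , distinct⇒Unique w w-distinct

∈-perms⁺ : ∀ m {w} → IsPerm m w → w ∈ perms m
∈-perms⁺ m {w} (|w|≡m , w⊆[m] , w!) =
  ∈-filter⁺ (T? ∘ distinct) (∈-words⁺ m [ m ] w |w|≡m w⊆[m]) (Unique⇒distinct w w!)

perms-Unique : ∀ m → Unique (perms m)
perms-Unique m = Unique.filter⁺ (T? ∘ distinct) (words-Unique m [ m ] (range-Unique m))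

perm-bounded : ∀ m {w} → w ∈ perms m → All (_< suc m) w
perm-bounded m w∈ = All.map (s≤s ∘ proj₂ ∘ ∈-range⁻) (proj₁ (proj₂ (∈-perms⁻ m w∈)))

perm-covers : ∀ m {w z} → w ∈ perms m → z ∈ [ m ] → z ∈ w
perm-covers m {w} {z} w∈ z∈ with z ∈? w
... | yes z∈w = z∈w
... | no  z∉w with ∈-perms⁻ m w∈ | ∈-∃++ z∈
...   | |w|≡m , w⊆[m] , w! | S₁ , S₂ , [m]≡ =
  contradiction |w|≤|S₁++S₂| (<⇒≱ (≤-reflexive |S₁++S₂|+1≡|w|))
  where
  |w|≤|S₁++S₂| : length w ≤ length (S₁ ++ S₂)
  |w|≤|S₁++S₂| = length-≤-Unique⊆ w (S₁ ++ S₂) w!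
    (All.tabulate (λ {y} y∈w → ∈-middle-≢ S₁ S₂ (subst (y ∈_) [m]≡ (All.lookup w⊆[m] y∈w))
                                             (λ y≡z → z∉w (subst (_∈ w) y≡z y∈w))))
  |S₁++S₂|+1≡|w| : suc (length (S₁ ++ S₂)) ≡ length w
  |S₁++S₂|+1≡|w| = trans (sym (length-middle S₁ z S₂))
                         (trans (cong length (sym [m]≡)) (trans (length-range m) (sym |w|≡m)))

-- A focus (a , y , b) of a permutation of [m+1] is the same as a value y, the permutation ρ
-- of [m] with map (bump y) ρ ≡ a ++ b, and a split of map (bump y) ρ.
module Decomposition (m : ℕ) where

  insertions : ℕ → List ℕ → List (List ℕ × ℕ × List ℕ)
  insertions v ρ = map (map₂ (v ,_)) (splits (map (bump v) ρ))

  byValue : List (List ℕ × ℕ × List ℕ)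
  byValue = concatMap (λ v → concatMap (insertions v) (perms m)) [ suc m ]

  byPerm : List (List ℕ × ℕ × List ℕ)
  byPerm = concatMap focuses (perms (suc m))

  byPerm⊆byValue : ∀ {t} → t ∈ byPerm → t ∈ byValue
  byPerm⊆byValue {a , y , b} t∈ with ∈-concatMap-∃⁻ focuses {xs = perms (suc m)} t∈
  ... | τ , τ∈ , t∈focuses with ∈-focuses⁻ τ t∈focuses
  ... | refl with ∈-perms⁻ (suc m) τ∈
  ... | |τ|≡m+1 , τ⊆[m+1] , τ! with Unique-middle⁻ a y b τ! | All-middle⁻ a y b τ⊆[m+1]
  ... | y≢ab , ab! | y∈ , ab⊆[m+1] =
    ∈-concatMap-∃⁺ _ y∈ (∈-concatMap-∃⁺ (insertions y) ρ∈ (∈-map⁺ (map₂ (y ,_)) ab∈))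
    where
    ρ : List ℕ
    ρ = map (unbump y) (a ++ b)
    bump-ρ : map (bump y) ρ ≡ a ++ b
    bump-ρ = map-bump-unbump y (a ++ b) y≢ab
    ρ∈ : ρ ∈ perms m
    ρ∈ = ∈-perms⁺ m
      ( trans (length-map (unbump y) (a ++ b)) (suc-injective (trans (sym (length-middle a y b)) |τ|≡m+1))
      , AllP.map⁺ (All.zipWith (λ (z∈ , y≢z) → unbump-range y _ y∈ z∈ y≢z) (ab⊆[m+1] , y≢ab))
      , Unique.map⁻ (subst Unique (sym bump-ρ) ab!) )
    ab∈ : (a , b) ∈ splits (map (bump y) ρ)
    ab∈ = subst (λ w → (a , b) ∈ splits w) (sym bump-ρ) (∈-splits⁺ a b)

  byValue⊆byPerm : ∀ {t} → t ∈ byValue → t ∈ byPerm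
  byValue⊆byPerm t∈ with ∈-concatMap-∃⁻ _ {xs = [ suc m ]} t∈
  ... | v , v∈ , t∈v with ∈-concatMap-∃⁻ (insertions v) {xs = perms m} t∈v
  ... | ρ , ρ∈ , t∈ρ with ∈-map⁻ (map₂ (v ,_)) t∈ρ
  ... | (a , b) , ab∈ , refl with ∈-perms⁻ m ρ∈
  ... | |ρ|≡m , ρ⊆[m] , ρ! = ∈-concatMap-∃⁺ focuses τ∈ (∈-focuses⁺ a v b)
    where
    ab≡bump-ρ : a ++ b ≡ map (bump v) ρ
    ab≡bump-ρ = ∈-splits⁻ (map (bump v) ρ) ab∈
    τ∈ : a ++ v ∷ b ∈ perms (suc m)
    τ∈ = ∈-perms⁺ (suc m)
      ( trans (length-middle a v b) (cong suc (trans (cong length ab≡bump-ρ) (trans (length-map (bump v) ρ) |ρ|≡m)))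
      , All-middle⁺ a b v∈
          (subst (All (_∈ [ suc m ])) (sym ab≡bump-ρ) (AllP.map⁺ (All.map (bump-range v _) ρ⊆[m])))
      , Unique-middle⁺ a v b
          (subst (All (v ≢_)) (sym ab≡bump-ρ) (AllP.map⁺ (All.tabulate (λ {z} _ → ≢-sym (bump-≢ v z)))))
          (subst Unique (sym ab≡bump-ρ) (Unique.map⁺ (bump-injective v) ρ!)) )

  byPerm-Unique : Unique byPerm
  byPerm-Unique = Unique-concatMap⁺ focuses focuses-Unique
    (λ {τ} {τ′} t∈τ t∈τ′ → trans (sym (∈-focuses⁻ τ t∈τ)) (∈-focuses⁻ τ′ t∈τ′))
    (perms-Unique (suc m))

  byValue-Unique : Unique byValue
  byValue-Unique = Unique-concatMap⁺ _
    (λ v → Unique-concatMap⁺ (insertions v) (λ ρ → Unique.map⁺ map₂-injective (splits-Unique _))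
                              same-ρ (perms-Unique m))
    same-v (range-Unique (suc m))
    where
    map₂-injective : ∀ {v} {p q : List ℕ × List ℕ} → map₂ (v ,_) p ≡ map₂ (v ,_) q → p ≡ q
    map₂-injective {p = _ , _} {q = _ , _} refl = refl
    same-ρ : ∀ {v ρ ρ′ t} → t ∈ insertions v ρ → t ∈ insertions v ρ′ → ρ ≡ ρ′
    same-ρ {v} {ρ} {ρ′} t∈ t∈′ with ∈-map⁻ (map₂ (v ,_)) t∈ | ∈-map⁻ (map₂ (v ,_)) t∈′
    ... | p , p∈ , refl | p′ , p′∈ , eq with map₂-injective {p = p} {q = p′} eq
    ... | refl = map-injective (bump-injective v) (trans (sym (∈-splits⁻ _ p∈)) (∈-splits⁻ _ p′∈))
    middle : ∀ {v t} → t ∈ concatMap (insertions v) (perms m) → proj₁ (proj₂ t) ≡ v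
    middle {v} t∈ with ∈-concatMap-∃⁻ (insertions v) {xs = perms m} t∈
    ... | _ , _ , t∈ρ with ∈-map⁻ (map₂ (v ,_)) t∈ρ
    ... | _ , _ , refl = refl
    same-v : ∀ {v v′ t} →
      t ∈ concatMap (insertions v) (perms m) → t ∈ concatMap (insertions v′) (perms m) → v ≡ v′
    same-v t∈ t∈′ = trans (sym (middle t∈)) (middle t∈′)

∑-focuses-perms : ∀ m (g : List ℕ × ℕ × List ℕ → ℕ) →
  ∑ (λ τ → ∑ g (focuses τ)) (perms (suc m))
    ≡ ∑ (λ v → ∑ (λ ρ → ∑ (λ (a , b) → g (a , v , b)) (splits (map (bump v) ρ))) (perms m)) [ suc m ]
∑-focuses-perms m g =
  begin
    ∑ (λ τ → ∑ g (focuses τ)) (perms (suc m))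
  ≡⟨ ∑-concatMap g focuses (perms (suc m)) ⟨
    ∑ g byPerm
  ≡⟨ ∑-sameMembers g byPerm-Unique byValue-Unique byPerm⊆byValue byValue⊆byPerm ⟩
    ∑ g byValue
  ≡⟨ ∑-concatMap g (λ v → concatMap (insertions v) (perms m)) [ suc m ] ⟩
    ∑ (λ v → ∑ g (concatMap (insertions v) (perms m))) [ suc m ]
  ≡⟨ ∑-cong (λ v → trans (∑-concatMap g (insertions v) (perms m))
                         (∑-cong (λ ρ → ∑-map g (map₂ (v ,_)) (splits (map (bump v) ρ))) (perms m))) [ suc m ] ⟩
    ∑ (λ v → ∑ (λ ρ → ∑ (λ (a , b) → g (a , v , b)) (splits (map (bump v) ρ))) (perms m)) [ suc m ]
  ∎
  where open Decomposition m

max∈range : ∀ m → suc m ∈ [ suc m ]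
max∈range m = ∈-range⁺ (s≤s z≤n) ≤-refl

∑-perms-insert-max : ∀ m (G : List ℕ → ℕ) →
  ∑ G (perms (suc m)) ≡ ∑ (λ ρ → ∑ (λ (a , b) → G (a ++ suc m ∷ b)) (splits ρ)) (perms m)
∑-perms-insert-max m G =
  begin
    ∑ G (perms (suc m))
  ≡⟨ ∑-cong-∈ (perms (suc m)) G≡∑focuses ⟩
    ∑ (λ τ → ∑ g (focuses τ)) (perms (suc m))
  ≡⟨ ∑-focuses-perms m g ⟩
    ∑ (λ v → ∑ (λ ρ → ∑ (λ (a , b) → g (a , v , b)) (splits (map (bump v) ρ))) (perms m)) [ suc m ]
  ≡⟨ ∑-cong (λ v → trans (∑-cong (λ ρ → ∑-*ˡ (𝟙 (v ≡ᵇ suc m)) _ (splits (map (bump v) ρ))) (perms m))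
                         (∑-*ˡ (𝟙 (v ≡ᵇ suc m)) (F v) (perms m))) [ suc m ] ⟩
    ∑ (λ v → 𝟙 (v ≡ᵇ suc m) * ∑ (F v) (perms m)) [ suc m ]
  ≡⟨ ∑-𝟙≡ᵇ (suc m) (λ v → ∑ (F v) (perms m)) [ suc m ] ⟩
    occurrences (suc m) [ suc m ] * ∑ (F (suc m)) (perms m)
  ≡⟨ cong (_* ∑ (F (suc m)) (perms m))
          (occurrences-Unique (suc m) [ suc m ] (range-Unique (suc m)) (max∈range m)) ⟩
    1 * ∑ (F (suc m)) (perms m)
  ≡⟨ *-identityˡ _ ⟩
    ∑ (F (suc m)) (perms m)
  ≡⟨ ∑-cong-∈ (perms m) (cong (∑ (λ (a , b) → G (a ++ suc m ∷ b)) ∘ splits)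
                         ∘ map-bump-below (suc m) _ ∘ perm-bounded m) ⟩
    ∑ (λ ρ → ∑ (λ (a , b) → G (a ++ suc m ∷ b)) (splits ρ)) (perms m)
  ∎
  where
  g : List ℕ × ℕ × List ℕ → ℕ
  g (a , y , b) = 𝟙 (y ≡ᵇ suc m) * G (a ++ y ∷ b)
  F : ℕ → List ℕ → ℕ
  F v ρ = ∑ (λ (a , b) → G (a ++ v ∷ b)) (splits (map (bump v) ρ))
  G≡∑focuses : ∀ {τ} → τ ∈ perms (suc m) → G τ ≡ ∑ g (focuses τ)
  G≡∑focuses {τ} τ∈ =
    begin
      G τ
    ≡⟨ *-identityˡ (G τ) ⟨
      1 * G τ
    ≡⟨ cong (_* G τ) (occurrences-Unique (suc m) τ (proj₂ (proj₂ (∈-perms⁻ (suc m) τ∈)))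
                                          (perm-covers (suc m) τ∈ (max∈range m))) ⟨
      occurrences (suc m) τ * G τ
    ≡⟨ ∑-focuses-𝟙≡ᵇ (suc m) G τ ⟨
      ∑ g (focuses τ)
    ∎

∑-range-1< : ∀ m → ∑ (𝟙 ∘ (1 <ᵇ_)) [ suc m ] ≡ m
∑-range-1< m = trans (cong (∑ (𝟙 ∘ (1 <ᵇ_))) (map-applyUpTo suc suc m))
                     (∑-applyUpTo-1 (𝟙 ∘ (1 <ᵇ_)) (suc ∘ suc) m (λ _ → refl))

runSorted-perm-head : ∀ m x σ → x ∷ σ ∈ perms (suc m) → increasing (starts (x ∷ σ)) ≡ true → x ≡ 1
runSorted-perm-head m x σ x∷σ∈ inc
  with perm-covers (suc m) x∷σ∈ (∈-range⁺ {suc m} (s≤s z≤n) (s≤s z≤n))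
... | here 1≡x = sym 1≡x
... | there 1∈σ with ∈-perms⁻ (suc m) x∷σ∈
...   | _ , x∈ ∷ _ , _ =
  ≤-antisym (All.lookup (increasing∷startsAfter⇒All≥ x x σ inc ≤-refl) 1∈σ) (proj₁ (∈-range⁻ x∈))

∑-values-newRunAt : ∀ m k σ → σ ∈ perms m →
  ∑ (λ v → ∑ (λ (a , b) → newRunAt (suc k) (a , v , b)) (splits (map (bump v) σ))) [ suc m ]
    ≡ m * 𝟙 (runSortedWith k σ)
∑-values-newRunAt m k [] σ∈ with ∈-perms⁻ m σ∈
... | refl , _ = refl
∑-values-newRunAt m k (x ∷ σ) σ∈ =
  begin
    ∑ (λ v → ∑ (λ (a , b) → newRunAt (suc k) (a , v , b)) (splits (map (bump v) (x ∷ σ)))) [ suc m ]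
  ≡⟨ ∑-cong one-position [ suc m ] ⟩
    ∑ (λ v → 𝟙 (x <ᵇ v) * 𝟙 (runSortedWith k (x ∷ σ))) [ suc m ]
  ≡⟨ ∑-cong (λ v → *-comm (𝟙 (x <ᵇ v)) _) [ suc m ] ⟩
    ∑ (λ v → 𝟙 (runSortedWith k (x ∷ σ)) * 𝟙 (x <ᵇ v)) [ suc m ]
  ≡⟨ ∑-*ˡ (𝟙 (runSortedWith k (x ∷ σ))) (𝟙 ∘ (x <ᵇ_)) [ suc m ] ⟩
    𝟙 (runSortedWith k (x ∷ σ)) * ∑ (𝟙 ∘ (x <ᵇ_)) [ suc m ]
  ≡⟨ values-above-head ⟩
    m * 𝟙 (runSortedWith k (x ∷ σ))
  ∎
  where
  one-position : ∀ v → ∑ (λ (a , b) → newRunAt (suc k) (a , v , b)) (splits (map (bump v) (x ∷ σ)))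
                         ≡ 𝟙 (x <ᵇ v) * 𝟙 (runSortedWith k (x ∷ σ))
  one-position v = trans (∑-newRunAt k v (bump v x) (map (bump v) σ) (All-bump-≢ v (x ∷ σ)))
                         (cong₂ _*_ (cong 𝟙 (bump-<ᵇ-self v x)) (cong 𝟙 (runSortedWith-bump k v (x ∷ σ))))
  values-above-head :
    𝟙 (runSortedWith k (x ∷ σ)) * ∑ (𝟙 ∘ (x <ᵇ_)) [ suc m ] ≡ m * 𝟙 (runSortedWith k (x ∷ σ))
  values-above-head with runSortedWith k (x ∷ σ) in rsw | ∈-perms⁻ m σ∈
  ... | false | _          = sym (*-zeroʳ m)
  ... | true  | refl , _ , _
    rewrite runSorted-perm-head (length σ) x σ σ∈ (proj₁ (∧≡true⇒ rsw)) =
    trans (+-identityʳ _) (trans (∑-range-1< (suc (length σ))) (sym (*-identityʳ _)))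

∑-splits-insert-max-perm : ∀ m k {ρ} → ρ ∈ perms (suc m) →
  ∑ (λ (a , b) → 𝟙 (runSortedWith k (a ++ suc (suc m) ∷ b))) (splits ρ)
    ≡ k * 𝟙 (runSortedWith k ρ) + ∑ (newRunAt k) (focuses ρ)
∑-splits-insert-max-perm m k {[]}    ρ∈ with () ← proj₁ (∈-perms⁻ (suc m) ρ∈)
∑-splits-insert-max-perm m k {x ∷ τ} ρ∈ with perm-bounded (suc m) ρ∈
... | x<n ∷ τ<n = ∑-splits-insert-max-runSortedWith k x τ x<n τ<n

∑-perms-newRunAt : ∀ m k →
  ∑ (λ ρ → ∑ (newRunAt (suc k)) (focuses ρ)) (perms (suc m)) ≡ m * r m k
∑-perms-newRunAt m k =
  begin
    ∑ (λ ρ → ∑ (newRunAt (suc k)) (focuses ρ)) (perms (suc m))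
  ≡⟨ ∑-focuses-perms m (newRunAt (suc k)) ⟩
    ∑ (λ v → ∑ (λ σ → newRunsAt v σ) (perms m)) [ suc m ]
  ≡⟨ ∑-comm (λ v σ → newRunsAt v σ) [ suc m ] (perms m) ⟩
    ∑ (λ σ → ∑ (λ v → newRunsAt v σ) [ suc m ]) (perms m)
  ≡⟨ ∑-cong-∈ (perms m) (∑-values-newRunAt m k _) ⟩
    ∑ (λ σ → m * 𝟙 (runSortedWith k σ)) (perms m)
  ≡⟨ trans (∑-*ˡ m _ (perms m)) (cong (m *_) (sym (r≡∑runSortedWith m k))) ⟩
    m * r m k
  ∎
  where
  newRunsAt : ℕ → List ℕ → ℕ
  newRunsAt v σ = ∑ (λ (a , b) → newRunAt (suc k) (a , v , b)) (splits (map (bump v) σ))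

theorem20 : ∀ (n k : ℕ) → n ≥ 2 → k ≥ 1 →
    r n k ≡ k * r (n ∸ 1) k + (n ∸ 2) * r (n ∸ 2) (k ∸ 1)
theorem20 (suc zero)    _       (s≤s ()) _
theorem20 (suc (suc m)) (suc k) _        _ =
  begin
    r (2 + m) (suc k)
  ≡⟨ r≡∑runSortedWith (2 + m) (suc k) ⟩
    ∑ (𝟙 ∘ runSortedWith (suc k)) (perms (2 + m))
  ≡⟨ ∑-perms-insert-max (suc m) (𝟙 ∘ runSortedWith (suc k)) ⟩
    ∑ (λ ρ → ∑ (λ (a , b) → 𝟙 (runSortedWith (suc k) (a ++ 2 + m ∷ b))) (splits ρ)) (perms (suc m))
  ≡⟨ ∑-cong-∈ (perms (suc m)) (∑-splits-insert-max-perm m (suc k)) ⟩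
    ∑ (λ ρ → suc k * 𝟙 (runSortedWith (suc k) ρ) + ∑ (newRunAt (suc k)) (focuses ρ)) (perms (suc m))
  ≡⟨ ∑-+ _ _ (perms (suc m)) ⟩
    ∑ (λ ρ → suc k * 𝟙 (runSortedWith (suc k) ρ)) (perms (suc m))
      + ∑ (λ ρ → ∑ (newRunAt (suc k)) (focuses ρ)) (perms (suc m))
  ≡⟨ cong₂ _+_ (∑-*ˡ (suc k) _ (perms (suc m))) (∑-perms-newRunAt m k) ⟩
    suc k * ∑ (𝟙 ∘ runSortedWith (suc k)) (perms (suc m)) + m * r m k
  ≡⟨ cong (λ c → suc k * c + m * r m k) (r≡∑runSortedWith (suc m) (suc k)) ⟨
    suc k * r (suc m) (suc k) + m * r m k
  ∎
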